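{- Let $G$ be a finite group of order $n$. Then $M(G)=B_{k(G)}$, where $$k(G)=\tfrac12\{n+k_2(G)\}-1,\qquad k_2(G)=\#\{x\in G: x^2=e\}.$$ In particular, if $n$ is odd then $M(G)=B_{\frac{n-1}{2}}$.
   Context: A metric $d$ on $G$ is right-invariant if $d(gh,g'h)=d(g,g')$ for all $g,g',h\in G$. Its induced partition $P(G,d)$ is the partition of $G$ into classes of the relation $g\sim h\iff d(g,e)=d(h,e)$. Two right-invariant metrics are $\mathcal{P}$-equivalent if they have the same induced partition. $M(G)$ denotes the number of $\mathcal{P}$-equivalence classes of right-invariant metrics on $G$. $B_m$ denotes the $m$-th Bell number (the number of partitions of an $m$-element set).
   Formalization: The right-invariant metrics on G take values in ℚ rather than in the nonnegative reals. -}

module Defs where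

open import Data.Nat using (ℕ; zero; suc; _+_; _*_; _∸_; _/_)
open import Data.Fin using (Fin; _≟_)
open import Data.List using (List; length; filter; allFin; map; upTo)
open import Data.Nat.ListAction using (sum)
open import Data.Rational using (ℚ; 0ℚ) renaming (_+_ to _+ℚ_; _≤_ to _≤ℚ_)
open import Data.Product using (Σ; _×_; _,_)
open import Function.Bundles using (_⇔_)
open import Relation.Binary.PropositionalEquality using (_≡_)
open import Relation.Nullary using (¬_)
open import Algebra.Structures using (IsGroup)
open import Level using (0ℓ)

-- A finite group of order n, presented on the carrier Fin n
-- (every finite group of order n is isomorphic to such a one).
record FiniteGroup (n : ℕ) : Set where
  field
    _∙_     : Fin n → Fin n → Fin n
    ε       : Fin n
    _⁻¹     : Fin n → Fin n
    isGroup : IsGroup _≡_ _∙_ ε _⁻¹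

module _ {n : ℕ} (G : FiniteGroup n) where
  open FiniteGroup G

  k₂ : ℕ
  k₂ = length (filter (λ x → (x ∙ x) ≟ ε) (allFin n))

  kG : ℕ
  kG = ((n + k₂) / 2) ∸ 1

  record IsMetric (d : Fin n → Fin n → ℚ) : Set where
    field
      zero⇒eq  : ∀ x y → d x y ≡ 0ℚ → x ≡ y
      eq⇒zero  : ∀ x → d x x ≡ 0ℚ
      symmetric : ∀ x y → d x y ≡ d y x
      triangle  : ∀ x y z → d x z ≤ℚ (d x y +ℚ d y z)

  RightInvariant : (Fin n → Fin n → ℚ) → Set
  RightInvariant d = ∀ g g' h → d (g ∙ h) (g' ∙ h) ≡ d g g'

  record RIMetric : Set where
    field
      dist      : Fin n → Fin n → ℚ
      isMetric  : IsMetric dist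
      rightInv  : RightInvariant dist

  InducedRel : RIMetric → Fin n → Fin n → Set
  InducedRel m g h = RIMetric.dist m g ε ≡ RIMetric.dist m h ε

  PEquiv : RIMetric → RIMetric → Set
  PEquiv m m' = ∀ g h → InducedRel m g h ⇔ InducedRel m' g h

  -- M(G) = c : there are exactly c P-equivalence classes of right-invariant
  -- metrics, i.e. a family of c metrics, pairwise non-P-equivalent, such that
  -- every right-invariant metric is P-equivalent to one of them.
  MEquals : ℕ → Set
  MEquals c = Σ (Fin c → RIMetric) λ f →
                (∀ i j → PEquiv (f i) (f j) → i ≡ j) ×
                (∀ m → Σ (Fin c) λ i → PEquiv m (f i))

S₂ : ℕ → ℕ → ℕ
S₂ zero    zero    = 1
S₂ zero    (suc k) = 0
S₂ (suc m) zero    = 0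
S₂ (suc m) (suc k) = suc k * S₂ m (suc k) + S₂ m k

Bell : ℕ → ℕ
Bell m = sum (map (S₂ m) (upTo (suc m)))

-- A right-invariant metric d is determined by its norm g ↦ d(g, ε), which vanishes exactly at ε,
-- is invariant under inversion and is subadditive; conversely such a norm N gives the
-- right-invariant metric d(x, y) = N(x y⁻¹). So an induced partition consists of {ε} and a
-- partition of the k orbits {g, g⁻¹}, g ≠ ε, of inversion; counting the k₂ fixed points of
-- inversion gives n + k₂ = 2(k + 1). Every partition of these k orbits is induced: give the
-- orbits in the b-th block the norm k + 1 + b. All non-zero norms then lie in [k + 1, 2k + 2],
-- which makes subadditivity automatic. Hence M(G) = B_k. If n is odd, an element t ≠ ε with
-- t² = ε is impossible, since g ↦ t g would be a fixed-point-free involution of G; so k₂ = 1.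

module Submission where

open import Algebra.Bundles using (Group)
import Algebra.Properties.Group as GroupProperties
open import Algebra.Structures using (IsGroup)
open import Data.Bool using (Bool; true; false; T; if_then_else_)
open import Data.Bool.Properties using (T-irrelevant)
open import Data.Empty using (⊥)
open import Data.Fin as Fin using (Fin; zero; suc; toℕ)
open import Data.Fin.Permutation using (Permutation; _⟨$⟩ʳ_; ↔⇒≡)
import Data.Fin.Properties as Finₚ
open Finₚ using (+↔⊎; *↔×; 0↔⊥; 1↔⊤)
open import Data.List using (filter; tabulate; length; applyUpTo)
open import Data.List.Properties using (map-applyUpTo)
open import Data.Nat as ℕ using (ℕ; zero; suc; _+_; _*_; _∸_; _%_; _/_)
open import Data.Nat.DivMod using (m*n%n≡0; m*n/n≡m)
open import Data.Nat.ListAction using (sum)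
import Data.Nat.Properties as ℕₚ
open import Data.Product using (Σ; _×_; _,_; proj₁; proj₂)
open import Data.Product.Function.Dependent.Propositional using (Σ-↔)
open import Data.Product.Function.NonDependent.Propositional using (_×-↔_)
open import Data.Rational using (ℚ; 0ℚ) renaming (_+_ to _+ℚ_; _≤_ to _≤ℚ_)
import Data.Rational.Properties as ℚₚ
open import Data.Sum using (_⊎_; inj₁; inj₂; [_,_])
open import Data.Sum.Function.Propositional using (_⊎-↔_)
open import Data.Unit using (⊤; tt)
open import Function using (id; _∘_; _⇔_; _↔_; mk↔ₛ′; mk⇔; Inverse; Equivalence; Injection)
open import Function.Construct.Composition using (_⇔-∘_)
open import Function.Construct.Symmetry using (⇔-sym)
open import Function.Definitions using (Injective)
open import Function.Properties.Inverse using (↔-refl; ↔-sym; ↔-trans; ↔⇒↣)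
open import Function.Related.Propositional using (module EquationalReasoning)
open import Level using (Level; 0ℓ)
open import Relation.Binary using (DecidableEquality)
import Relation.Binary.Reasoning.Setoid as SetoidReasoning
open import Relation.Binary.PropositionalEquality
  using (_≡_; _≢_; refl; sym; trans; cong; cong₂; subst; subst₂; module ≡-Reasoning)
open import Relation.Nullary using (Dec; yes; no; does; ⌊_⌋; toWitness; fromWitness; contradiction; ¬?; _×-dec_)
open import Relation.Nullary.Decidable using (dec-false; isYes≗does; does-⇔)
open import Relation.Unary using (Decidable)

open import Algebra.Properties.CommutativeMonoid.Sum ℕₚ.+-0-commutativeMonoid
  using (sum-syntax; sum-cong-≗; ∑-distrib-+; ∑-permute)

open import Defs

private variable
  a b c d : Level
  A : Set a
  B : Set b
  C : Set c
  D : Set d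

m+m≡m*2 : ∀ m → m + m ≡ m * 2
m+m≡m*2 m = trans (cong (m +_) (sym (ℕₚ.+-identityʳ m))) (ℕₚ.*-comm 2 m)

m+m%2≡0 : ∀ m → (m + m) % 2 ≡ 0
m+m%2≡0 m = trans (cong (_% 2) (m+m≡m*2 m)) (m*n%n≡0 m 2)

[m+m]/2≡m : ∀ m → (m + m) / 2 ≡ m
[m+m]/2≡m m = trans (cong (_/ 2) (m+m≡m*2 m)) (m*n/n≡m m 2)

Σ-Fin-zero-↔ : {P : Fin 0 → Set a} → ⊥ ↔ Σ (Fin 0) P
Σ-Fin-zero-↔ = mk↔ₛ′ (λ ()) (λ ()) (λ ()) (λ ())

Σ-Fin-suc-↔ : ∀ {n} {P : Fin (suc n) → Set a} → (P zero ⊎ Σ (Fin n) (P ∘ suc)) ↔ Σ (Fin (suc n)) P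
Σ-Fin-suc-↔ = mk↔ₛ′
  (λ { (inj₁ p) → zero , p ; (inj₂ (i , p)) → suc i , p })
  (λ { (zero , p) → inj₁ p ; (suc i , p) → inj₂ (i , p) })
  (λ { (zero , p) → refl ; (suc i , p) → refl })
  (λ { (inj₁ p) → refl ; (inj₂ (i , p)) → refl })

Σ-T-≡ : {p : A → Bool} {x y : A} {s : T (p x)} {t : T (p y)} →
        x ≡ y → _≡_ {A = Σ A (T ∘ p)} (x , s) (y , t)
Σ-T-≡ refl = cong (_ ,_) (T-irrelevant _ _)

⌊⌋-⇔ : A ⇔ B → (a? : Dec A) (b? : Dec B) → ⌊ a? ⌋ ≡ ⌊ b? ⌋
⌊⌋-⇔ A⇔B a? b? = trans (isYes≗does a?) (trans (does-⇔ A⇔B a? b?) (sym (isYes≗does b?)))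

-- Counting subsets of Fin n

χ : Bool → ℕ
χ b = if b then 1 else 0

χ-↔ : ∀ b → Fin (χ b) ↔ T b
χ-↔ true  = 1↔⊤
χ-↔ false = 0↔⊥

χ-split : (a? : Dec A) (b? : Dec B) → (A → B) → χ ⌊ b? ⌋ ≡ χ ⌊ a? ⌋ + χ ⌊ ¬? a? ×-dec b? ⌋
χ-split (yes _) (yes _) _   = refl
χ-split (yes a) (no ¬b) a⇒b = contradiction (a⇒b a) ¬b
χ-split (no _)  (yes _) _   = refl
χ-split (no _)  (no _)  _   = refl

χ≤?+χ≥?≡1+χ≟ : ∀ {n} (i j : Fin n) → χ ⌊ i Finₚ.≤? j ⌋ + χ ⌊ j Finₚ.≤? i ⌋ ≡ 1 + χ ⌊ i Finₚ.≟ j ⌋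
χ≤?+χ≥?≡1+χ≟ i j with i Finₚ.≤? j | j Finₚ.≤? i | i Finₚ.≟ j
... | yes _   | yes _   | yes _   = refl
... | yes i≤j | yes j≤i | no i≢j  = contradiction (Finₚ.≤-antisym i≤j j≤i) i≢j
... | yes _   | no _    | no _    = refl
... | yes _   | no j≰i  | yes i≡j = contradiction (Finₚ.≤-reflexive (sym i≡j)) j≰i
... | no _    | yes _   | no _    = refl
... | no i≰j  | yes _   | yes i≡j = contradiction (Finₚ.≤-reflexive i≡j) i≰j
... | no i≰j  | no j≰i  | _       = contradiction (Finₚ.≤-total i j) [ i≰j , j≰i ]

count : ∀ {n} → (Fin n → Bool) → ℕ
count {n} p = ∑[ x < n ] χ (p x)

count-↔ : ∀ {n} (p : Fin n → Bool) → Fin (count p) ↔ Σ (Fin n) (T ∘ p)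
count-↔ {zero}  p = ↔-trans 0↔⊥ Σ-Fin-zero-↔
count-↔ {suc n} p =
  Fin (χ (p zero) + count (p ∘ suc))          ↔⟨ +↔⊎ ⟩
  (Fin (χ (p zero)) ⊎ Fin (count (p ∘ suc)))  ↔⟨ χ-↔ (p zero) ⊎-↔ count-↔ (p ∘ suc) ⟩
  (T (p zero) ⊎ Σ (Fin n) (T ∘ p ∘ suc))      ↔⟨ Σ-Fin-suc-↔ ⟩
  Σ (Fin (suc n)) (T ∘ p)                     ∎
  where open EquationalReasoning

count-cong : ∀ {n} {p q : Fin n → Bool} → (∀ x → p x ≡ q x) → count p ≡ count q
count-cong p≗q = sum-cong-≗ (cong χ ∘ p≗q)

count-permute : ∀ {n} (p : Fin n → Bool) (π : Permutation n n) → count p ≡ count (p ∘ (π ⟨$⟩ʳ_))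
count-permute p π = ∑-permute (χ ∘ p) π

count-true : ∀ n → count {n} (λ _ → true) ≡ n
count-true zero    = refl
count-true (suc n) = cong suc (count-true n)

count-false : ∀ n → count {n} (λ _ → false) ≡ 0
count-false zero    = refl
count-false (suc n) = count-false n

count-≟ : ∀ {n} (c : Fin n) → count (λ x → ⌊ x Finₚ.≟ c ⌋) ≡ 1
count-≟ c = ↔⇒≡ (↔-trans (count-↔ _) (↔-trans singleton↔⊤ (↔-sym 1↔⊤)))
  where
  singleton↔⊤ : Σ (Fin _) (λ x → T ⌊ x Finₚ.≟ c ⌋) ↔ ⊤
  singleton↔⊤ = mk↔ₛ′ _ (λ _ → c , fromWitness refl) (λ _ → refl)
                       (λ (x , x≡c) → Σ-T-≡ (sym (toWitness x≡c)))

length-filter-tabulate : {P : A → Set b} (P? : Decidable P) {n : ℕ} (f : Fin n → A) →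
                         length (filter P? (tabulate f)) ≡ count (λ i → does (P? (f i)))
length-filter-tabulate P? {zero}  f = refl
length-filter-tabulate P? {suc n} f with does (P? (f zero))
... | true  = cong suc (length-filter-tabulate P? (f ∘ suc))
... | false = length-filter-tabulate P? (f ∘ suc)

-- Involutions of Fin n

module Involution {n} (σ : Fin n → Fin n) (σ-involutive : ∀ x → σ (σ x) ≡ x) where

  open Finₚ using (_≤?_; _≟_)

  isMinimal : Fin n → Bool
  isMinimal x = ⌊ x ≤? σ x ⌋

  isFixed : Fin n → Bool
  isFixed x = ⌊ x ≟ σ x ⌋

  -- Every x satisfies x ≤ σ x or σ x ≤ x, and both exactly when it is fixed; the two
  -- counts agree because σ is a permutation.
  n+#fixed≡2#minimal : n + count isFixed ≡ count isMinimal + count isMinimal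
  n+#fixed≡2#minimal = begin
    n + count isFixed                                ≡⟨ cong (_+ count isFixed) (count-true n) ⟨
    count {n} (λ _ → true) + count isFixed           ≡⟨ ∑-distrib-+ {n} (λ _ → 1) (χ ∘ isFixed) ⟨
    ∑[ x < n ] (1 + χ (isFixed x))                   ≡⟨ sum-cong-≗ (λ x → χ≤?+χ≥?≡1+χ≟ x (σ x)) ⟨
    ∑[ x < n ] (χ (isMinimal x) + χ ⌊ σ x ≤? x ⌋)    ≡⟨ ∑-distrib-+ {n} (χ ∘ isMinimal) (λ x → χ ⌊ σ x ≤? x ⌋) ⟩
    count isMinimal + count (λ x → ⌊ σ x ≤? x ⌋)     ≡⟨ cong (count isMinimal +_) #σ-minimal≡#minimal ⟩
    count isMinimal + count isMinimal                ∎
    where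
    open ≡-Reasoning
    #σ-minimal≡#minimal : count (λ x → ⌊ σ x ≤? x ⌋) ≡ count isMinimal
    #σ-minimal≡#minimal = begin
      count (λ x → ⌊ σ x ≤? x ⌋)  ≡⟨ count-cong (λ x → cong (λ y → ⌊ σ x ≤? y ⌋) (σ-involutive x)) ⟨
      count (isMinimal ∘ σ)       ≡⟨ count-permute isMinimal (mk↔ₛ′ σ σ σ-involutive σ-involutive) ⟨
      count isMinimal             ∎

  fixedPointFree⇒even : (∀ x → x ≢ σ x) → n % 2 ≡ 0
  fixedPointFree⇒even x≢σx = begin
    n % 2                                     ≡⟨ cong (_% 2) (ℕₚ.+-identityʳ n) ⟨
    (n + 0) % 2                               ≡⟨ cong (λ m → (n + m) % 2) #fixed≡0 ⟨
    (n + count isFixed) % 2                   ≡⟨ cong (_% 2) n+#fixed≡2#minimal ⟩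
    (count isMinimal + count isMinimal) % 2   ≡⟨ m+m%2≡0 (count isMinimal) ⟩
    0                                         ∎
    where
    open ≡-Reasoning
    #fixed≡0 : count isFixed ≡ 0
    #fixed≡0 = trans (count-cong (λ x → trans (isYes≗does _) (dec-false (x ≟ σ x) (x≢σx x)))) (count-false n)

  minRep : Fin n → Fin n
  minRep x with x ≤? σ x
  ... | yes _ = x
  ... | no  _ = σ x

  minRep-≡ : ∀ x → minRep x ≡ x ⊎ minRep x ≡ σ x
  minRep-≡ x with x ≤? σ x
  ... | yes _ = inj₁ refl
  ... | no  _ = inj₂ refl

  minRep-minimal : ∀ x → minRep x Fin.≤ σ (minRep x)
  minRep-minimal x with x ≤? σ x
  ... | yes x≤σx = x≤σx
  ... | no  x≰σx = subst (σ x Fin.≤_) (sym (σ-involutive x)) (ℕₚ.≰⇒≥ x≰σx)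

  minRep-fixes : ∀ {x} → x Fin.≤ σ x → minRep x ≡ x
  minRep-fixes {x} x≤σx with x ≤? σ x
  ... | yes _   = refl
  ... | no x≰σx = contradiction x≤σx x≰σx

  minRep-σ : ∀ x → minRep (σ x) ≡ minRep x
  minRep-σ x with x ≤? σ x | σ x ≤? σ (σ x)
  ... | yes x≤σx | yes σx≤σσx = Finₚ.≤-antisym (subst (σ x Fin.≤_) (σ-involutive x) σx≤σσx) x≤σx
  ... | yes _    | no  _      = σ-involutive x
  ... | no  _    | yes _      = refl
  ... | no x≰σx  | no σx≰σσx  =
    contradiction (Finₚ.≤-total x (σ x)) [ x≰σx , σx≰σσx ∘ subst (σ x Fin.≤_) (sym (σ-involutive x)) ]

-- Kernels

≡⇔≡-flip : {x y : A} {u v : B} → x ≡ y ⇔ u ≡ v → y ≡ x ⇔ v ≡ u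
≡⇔≡-flip x≡y⇔u≡v = mk⇔ (sym ∘ Equivalence.to x≡y⇔u≡v ∘ sym) (sym ∘ Equivalence.from x≡y⇔u≡v ∘ sym)

SameKernel : (A → B) → (A → C) → Set _
SameKernel f g = ∀ x y → f x ≡ f y ⇔ g x ≡ g y

SameKernel-sym : {f : A → B} {g : A → C} → SameKernel f g → SameKernel g f
SameKernel-sym same x y = ⇔-sym (same x y)

SameKernel-trans : {f : A → B} {g : A → C} {h : A → D} → SameKernel f g → SameKernel g h → SameKernel f h
SameKernel-trans same same′ x y = same′ x y ⇔-∘ same x y

≗⇒SameKernel : {f g : A → B} → (∀ x → f x ≡ g x) → SameKernel f g
≗⇒SameKernel {f = f} {g} f≗g x y = subst₂ (λ u v → f x ≡ f y ⇔ u ≡ v) (f≗g x) (f≗g y) (mk⇔ id id)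

injective⇒SameKernel : {f : A → B} {h : B → C} → Injective _≡_ _≡_ h → SameKernel f (h ∘ f)
injective⇒SameKernel {h = h} h-injective x y = mk⇔ (cong h) h-injective

SameKernel-reflect-∘ : {f : A → B} {g : A → C} (h : D → A) (s : A → D) →
                       (∀ x → h (s x) ≡ x) → SameKernel (f ∘ h) (g ∘ h) → SameKernel f g
SameKernel-reflect-∘ {f = f} {g} h s h∘s≗id same x y =
  subst₂ (λ u v → f u ≡ f v ⇔ g u ≡ g v) (h∘s≗id x) (h∘s≗id y) (same (s x) (s y))

SameKernel-extend : ∀ {k} {f : Fin (suc k) → B} {g : Fin (suc k) → C} →
                    (∀ x → f zero ≢ f (suc x)) → (∀ x → g zero ≢ g (suc x)) →
                    SameKernel (f ∘ suc) (g ∘ suc) → SameKernel f g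
SameKernel-extend f₀≢ g₀≢ same zero    zero    = mk⇔ (λ _ → refl) (λ _ → refl)
SameKernel-extend f₀≢ g₀≢ same zero    (suc y) = mk⇔ (λ q → contradiction q (f₀≢ y)) (λ q → contradiction q (g₀≢ y))
SameKernel-extend {f = f} {g} f₀≢ g₀≢ same (suc x) zero =
  ≡⇔≡-flip (SameKernel-extend {f = f} {g} f₀≢ g₀≢ same zero (suc x))
SameKernel-extend f₀≢ g₀≢ same (suc x) (suc y) = same x y

-- Set partitions and Bell numbers

-- Partitions of Fin m into j blocks, canonically labelled: element zero either joins one of the
-- blocks of a partition of the other m elements or opens a new block, labelled j. This mirrors
-- the recurrence S₂ (m + 1) (j + 1) = (j + 1) S₂ m (j + 1) + S₂ m j.
Partition : ℕ → ℕ → Set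
Partition zero    zero    = ⊤
Partition zero    (suc j) = ⊥
Partition (suc m) zero    = ⊥
Partition (suc m) (suc j) = (Fin (suc j) × Partition m (suc j)) ⊎ Partition m j

pattern join b p = inj₁ (b , p)
pattern new p    = inj₂ p

block : ∀ {m j} → Partition m j → Fin m → Fin j
block {suc m} {suc j} (join b p) zero    = b
block {suc m} {suc j} (join b p) (suc x) = block p x
block {suc m} {suc j} (new p)    zero    = Fin.fromℕ j
block {suc m} {suc j} (new p)    (suc x) = Fin.inject₁ (block p x)

Partition-bound : ∀ {m j} → Partition m j → j ℕ.≤ m
Partition-bound {zero}  {zero}  _          = ℕ.z≤n
Partition-bound {suc m} {suc j} (join _ p) = ℕₚ.m≤n⇒m≤1+n (Partition-bound p)
Partition-bound {suc m} {suc j} (new p)    = ℕ.s≤s (Partition-bound p)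

block-surjective : ∀ {m j} (p : Partition m j) (b : Fin j) → Σ (Fin m) λ x → block p x ≡ b
block-surjective {zero}  {zero}  _ ()
block-surjective {suc m} {suc j} (join _ p) b with block-surjective p b
... | x , px≡b = suc x , px≡b
block-surjective {suc m} {suc j} (new p) b with j ℕ.≟ toℕ b
... | yes j≡b = zero , Finₚ.toℕ-injective (trans (Finₚ.toℕ-fromℕ j) j≡b)
... | no  j≢b with block-surjective p (Fin.lower₁ b j≢b)
...   | x , px≡b = suc x , trans (cong Fin.inject₁ px≡b) (Finₚ.inject₁-lower₁ b j≢b)

block-kernel-injective : ∀ {m j j′} (p : Partition m j) (p′ : Partition m j′) →
                         SameKernel (block p) (block p′) → _≡_ {A = Σ ℕ (Partition m)} (j , p) (j′ , p′)
block-kernel-injective {zero}  {zero}  {zero}   _ _ _ = refl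
block-kernel-injective {suc m} {suc j} {suc j′} (join b p) (join b′ p′) same
  with block-kernel-injective p p′ (λ x y → same (suc x) (suc y))
... | refl with block-surjective p b
...   | x , px≡b =
  cong (λ c → suc j , join c p) (trans (sym px≡b) (sym (Equivalence.to (same zero (suc x)) (sym px≡b))))
block-kernel-injective {suc m} {suc j} {suc j′} (join b p) (new p′) same with block-surjective p b
... | x , px≡b = contradiction (Equivalence.to (same zero (suc x)) (sym px≡b)) Finₚ.fromℕ≢inject₁
block-kernel-injective {suc m} {suc j} {suc j′} (new p) (join b′ p′) same with block-surjective p′ b′
... | x , p′x≡b′ = contradiction (Equivalence.from (same zero (suc x)) (sym p′x≡b′)) Finₚ.fromℕ≢inject₁
block-kernel-injective {suc m} {suc j} {suc j′} (new p) (new p′) same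
  with block-kernel-injective p p′ (λ x y → mk⇔
         (Finₚ.inject₁-injective ∘ Equivalence.to (same (suc x) (suc y)) ∘ cong Fin.inject₁)
         (Finₚ.inject₁-injective ∘ Equivalence.from (same (suc x) (suc y)) ∘ cong Fin.inject₁))
... | refl = refl

fibrePartition : DecidableEquality A → ∀ {m} (v : Fin m → A) →
                 Σ (Σ ℕ (Partition m)) λ (j , p) → SameKernel (block p) v
fibrePartition _≟_ {zero}  v = (zero , tt) , λ ()
fibrePartition _≟_ {suc m} v with fibrePartition _≟_ (v ∘ suc) | Finₚ.any? (λ x → v zero ≟ v (suc x))
... | (zero , p) , _ | yes (x , _) = contradiction (block p x) Finₚ.¬Fin0
... | (suc j , p) , same | yes (x , v₀≡vx) = (suc j , join (block p x) p) , same′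
  where
  open Equivalence
  same′ : SameKernel (block (join (block p x) p)) v
  same′ zero    zero    = mk⇔ (λ _ → refl) (λ _ → refl)
  same′ zero    (suc y) = mk⇔ (trans v₀≡vx ∘ to (same x y)) (from (same x y) ∘ trans (sym v₀≡vx))
  same′ (suc y) zero    = ≡⇔≡-flip (same′ zero (suc y))
  same′ (suc y) (suc z) = same y z
... | (j , p) , same | no v₀≢v = (suc j , new p) , same′
  where
  open Equivalence
  same′ : SameKernel (block (new p)) v
  same′ zero    zero    = mk⇔ (λ _ → refl) (λ _ → refl)
  same′ zero    (suc y) = mk⇔ (λ q → contradiction q Finₚ.fromℕ≢inject₁) (λ q → contradiction (y , q) v₀≢v)
  same′ (suc y) zero    = ≡⇔≡-flip (same′ zero (suc y))
  same′ (suc y) (suc z) = mk⇔ (to (same y z) ∘ Finₚ.inject₁-injective) (cong Fin.inject₁ ∘ from (same y z))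

S₂-↔ : ∀ m j → Fin (S₂ m j) ↔ Partition m j
S₂-↔ zero    zero    = 1↔⊤
S₂-↔ zero    (suc j) = 0↔⊥
S₂-↔ (suc m) zero    = 0↔⊥
S₂-↔ (suc m) (suc j) =
  Fin (suc j * S₂ m (suc j) + S₂ m j)                   ↔⟨ +↔⊎ ⟩
  (Fin (suc j * S₂ m (suc j)) ⊎ Fin (S₂ m j))           ↔⟨ *↔× ⊎-↔ ↔-refl ⟩
  ((Fin (suc j) × Fin (S₂ m (suc j))) ⊎ Fin (S₂ m j))   ↔⟨ (↔-refl ×-↔ S₂-↔ m (suc j)) ⊎-↔ S₂-↔ m j ⟩
  Partition (suc m) (suc j)                             ∎
  where open EquationalReasoning

sum-applyUpTo-↔ : ∀ (f : ℕ → ℕ) k → Fin (sum (applyUpTo f k)) ↔ Σ (Fin k) (λ i → Fin (f (toℕ i)))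
sum-applyUpTo-↔ f zero    = ↔-trans 0↔⊥ Σ-Fin-zero-↔
sum-applyUpTo-↔ f (suc k) =
  Fin (f 0 + sum (applyUpTo (f ∘ suc) k))                ↔⟨ +↔⊎ ⟩
  (Fin (f 0) ⊎ Fin (sum (applyUpTo (f ∘ suc) k)))        ↔⟨ ↔-refl ⊎-↔ sum-applyUpTo-↔ (f ∘ suc) k ⟩
  (Fin (f 0) ⊎ Σ (Fin k) (λ i → Fin (f (suc (toℕ i)))))  ↔⟨ Σ-Fin-suc-↔ ⟩
  Σ (Fin (suc k)) (λ i → Fin (f (toℕ i)))                ∎
  where open EquationalReasoning

Σ-Fin-↔-Σ-ℕ : ∀ {k} {P : ℕ → Set a} → (∀ {j} → P j → j ℕ.< k) → Σ (Fin k) (P ∘ toℕ) ↔ Σ ℕ P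
Σ-Fin-↔-Σ-ℕ {P = P} bound = mk↔ₛ′ forget restrict forget∘restrict (λ x → forget-injective (forget∘restrict (forget x)))
  where
  forget : Σ (Fin _) (P ∘ toℕ) → Σ ℕ P
  forget (i , p) = toℕ i , p
  restrict : Σ ℕ P → Σ (Fin _) (P ∘ toℕ)
  restrict (j , p) = Fin.fromℕ< (bound p) , subst P (sym (Finₚ.toℕ-fromℕ< (bound p))) p
  transport : ∀ {i j} (i≡j : i ≡ j) (p : P j) → _≡_ {A = Σ ℕ P} (i , subst P (sym i≡j) p) (j , p)
  transport refl p = refl
  forget∘restrict : ∀ x → forget (restrict x) ≡ x
  forget∘restrict (j , p) = transport (Finₚ.toℕ-fromℕ< (bound p)) p
  forget-injective : ∀ {x y} → forget x ≡ forget y → x ≡ y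
  forget-injective {i , p} {i′ , p′} eq with Finₚ.toℕ-injective (cong proj₁ eq)
  forget-injective {i , p} {.i , .p} refl | refl = refl

Bell-↔ : ∀ m → Fin (Bell m) ↔ Σ ℕ (Partition m)
Bell-↔ m =
  Fin (Bell m)                                ≡⟨ cong (Fin ∘ sum) (map-applyUpTo id (S₂ m) (suc m)) ⟩
  Fin (sum (applyUpTo (S₂ m) (suc m)))        ↔⟨ sum-applyUpTo-↔ (S₂ m) (suc m) ⟩
  Σ (Fin (suc m)) (λ j → Fin (S₂ m (toℕ j)))  ↔⟨ Σ-↔ ↔-refl (S₂-↔ m _) ⟩
  Σ (Fin (suc m)) (Partition m ∘ toℕ)         ↔⟨ Σ-Fin-↔-Σ-ℕ (ℕ.s≤s ∘ Partition-bound) ⟩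
  Σ ℕ (Partition m)                           ∎
  where open EquationalReasoning

-- Natural numbers as rationals

module ℕ↪ℚ where

  open import Data.Integer as ℤ using (+_)
  import Data.Integer.Properties as ℤₚ
  open import Data.Rational using (*≤*; ↥_)
  open import Data.Rational.Literals using (fromℤ)
  open import Data.Rational.Properties using (toℚᵘ-injective; toℚᵘ-homo-+)
  import Data.Rational.Unnormalised as ℚᵘ
  import Data.Rational.Unnormalised.Properties as ℚᵘₚ

  fromℕ : ℕ → ℚ
  fromℕ n = fromℤ (+ n)

  fromℕ-injective : ∀ {m n} → fromℕ m ≡ fromℕ n → m ≡ n
  fromℕ-injective eq = ℤₚ.+-injective (cong ↥_ eq)

  fromℕ-mono-≤ : ∀ {m n} → m ℕ.≤ n → fromℕ m ≤ℚ fromℕ n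
  fromℕ-mono-≤ {m} {n} m≤n = *≤* (subst₂ ℤ._≤_ (sym (ℤₚ.*-identityʳ (+ m))) (sym (ℤₚ.*-identityʳ (+ n))) (ℤ.+≤+ m≤n))

  fromℕ-+ : ∀ m n → fromℕ (m + n) ≡ fromℕ m +ℚ fromℕ n
  fromℕ-+ m n = toℚᵘ-injective (ℚᵘₚ.≃-trans (ℚᵘ.*≡* cross) (ℚᵘₚ.≃-sym (toℚᵘ-homo-+ (fromℕ m) (fromℕ n))))
    where
    open ≡-Reasoning
    cross : + (m + n) ℤ.* + 1 ≡ (+ m ℤ.* + 1 ℤ.+ + n ℤ.* + 1) ℤ.* + 1
    cross = begin
      + (m + n) ℤ.* + 1                      ≡⟨ ℤₚ.*-identityʳ _ ⟩
      + (m + n)                              ≡⟨ ℤₚ.pos-+ m n ⟩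
      + m ℤ.+ + n                            ≡⟨ cong₂ ℤ._+_ (ℤₚ.*-identityʳ (+ m)) (ℤₚ.*-identityʳ (+ n)) ⟨
      + m ℤ.* + 1 ℤ.+ + n ℤ.* + 1            ≡⟨ ℤₚ.*-identityʳ _ ⟨
      (+ m ℤ.* + 1 ℤ.+ + n ℤ.* + 1) ℤ.* + 1  ∎

open ℕ↪ℚ

-- Norms and right-invariant metrics

module RightDivision {a ℓ} (𝒢 : Group a ℓ) where

  open Group 𝒢
  open GroupProperties 𝒢 using (⁻¹-anti-homo-∙; //-rightDividesˡ; //-rightDividesʳ; ε⁻¹≈ε)
  open SetoidReasoning setoid

  x∙z//y∙z≈x//y : ∀ x y z → (x ∙ z) // (y ∙ z) ≈ x // y
  x∙z//y∙z≈x//y x y z = begin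
    (x ∙ z) ∙ (y ∙ z) ⁻¹     ≈⟨ ∙-congˡ (⁻¹-anti-homo-∙ y z) ⟩
    (x ∙ z) ∙ (z ⁻¹ ∙ y ⁻¹)  ≈⟨ assoc (x ∙ z) (z ⁻¹) (y ⁻¹) ⟨
    ((x ∙ z) // z) ∙ y ⁻¹    ≈⟨ ∙-congʳ (//-rightDividesʳ z x) ⟩
    x // y                   ∎

  x//y∙y//z≈x//z : ∀ x y z → (x // y) ∙ (y // z) ≈ x // z
  x//y∙y//z≈x//z x y z = begin
    (x // y) ∙ (y ∙ z ⁻¹)  ≈⟨ assoc (x // y) y (z ⁻¹) ⟨
    (x // y) ∙ y ∙ z ⁻¹    ≈⟨ ∙-congʳ (//-rightDividesˡ y x) ⟩
    x // z                 ∎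

  x//ε≈x : ∀ x → x // ε ≈ x
  x//ε≈x x = begin
    x ∙ ε ⁻¹  ≈⟨ ∙-congˡ ε⁻¹≈ε ⟩
    x ∙ ε     ≈⟨ identityʳ x ⟩
    x         ∎

group : ∀ {n} → FiniteGroup n → Group 0ℓ 0ℓ
group G = record { _≈_ = _≡_ ; _∙_ = _∙_ ; ε = ε ; _⁻¹ = _⁻¹ ; isGroup = isGroup }
  where open FiniteGroup G

module Norms {n} (G : FiniteGroup n) where

  open FiniteGroup G
  open IsGroup isGroup using (_//_; identityˡ; identityʳ; inverseˡ; inverseʳ)
  open GroupProperties (group G) using (⁻¹-anti-homo-//; x∙y⁻¹≈ε⇒x≈y)
  open RightDivision (group G)

  record IsNorm (f : Fin n → ℕ) : Set where
    field
      ≡0⇒≡ε        : ∀ g → f g ≡ 0 → g ≡ ε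
      ε↦0          : f ε ≡ 0
      ⁻¹-invariant : ∀ g → f (g ⁻¹) ≡ f g
      subadditive  : ∀ g h → f (g ∙ h) ℕ.≤ f g + f h

  normMetric : ∀ {f} → IsNorm f → RIMetric G
  normMetric {f} isNorm = record
    { dist     = dist
    ; isMetric = record
      { zero⇒eq   = λ x y dxy≡0 → x∙y⁻¹≈ε⇒x≈y x y (≡0⇒≡ε (x // y) (fromℕ-injective dxy≡0))
      ; eq⇒zero   = λ x → cong fromℕ (trans (cong f (inverseʳ x)) ε↦0)
      ; symmetric = λ x y → cong fromℕ (trans (sym (⁻¹-invariant (x // y))) (cong f (⁻¹-anti-homo-// x y)))
      ; triangle  = λ x y z → subst (dist x z ≤ℚ_) (fromℕ-+ (f (x // y)) (f (y // z)))
                                (fromℕ-mono-≤ (subst (λ w → f w ℕ.≤ f (x // y) + f (y // z))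
                                  (x//y∙y//z≈x//z x y z) (subadditive (x // y) (y // z))))
      }
    ; rightInv = λ g g′ h → cong (fromℕ ∘ f) (x∙z//y∙z≈x//y g g′ h)
    }
    where
    open IsNorm isNorm
    dist : Fin n → Fin n → ℚ
    dist x y = fromℕ (f (x // y))

  -- PEquiv G m m′ unfolds to SameKernel (norm m) (norm m′).
  norm : RIMetric G → Fin n → ℚ
  norm m g = RIMetric.dist m g ε

  normMetric-kernel : ∀ {f} (isNorm : IsNorm f) → SameKernel (norm (normMetric isNorm)) f
  normMetric-kernel {f} _ = SameKernel-sym (SameKernel-trans (injective⇒SameKernel fromℕ-injective)
                                              (≗⇒SameKernel (λ g → cong (fromℕ ∘ f) (sym (x//ε≈x g)))))

  module _ (m : RIMetric G) where

    open RIMetric m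
    open IsMetric isMetric

    norm-ε : norm m ε ≡ 0ℚ
    norm-ε = eq⇒zero ε

    norm≡0⇒≡ε : ∀ g → norm m g ≡ 0ℚ → g ≡ ε
    norm≡0⇒≡ε g = zero⇒eq g ε

    norm-⁻¹ : ∀ g → norm m (g ⁻¹) ≡ norm m g
    norm-⁻¹ g = begin
      dist (g ⁻¹) ε              ≡⟨ rightInv (g ⁻¹) ε g ⟨
      dist ((g ⁻¹) ∙ g) (ε ∙ g)  ≡⟨ cong₂ dist (inverseˡ g) (identityˡ g) ⟩
      dist ε g                   ≡⟨ symmetric ε g ⟩
      dist g ε                   ∎
      where open ≡-Reasoning

  bounded⇒subadditive : ∀ {f : Fin n → ℕ} c → f ε ≡ 0 → (∀ g → g ≢ ε → c ℕ.≤ f g × f g ℕ.≤ c + c) →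
                        ∀ g h → f (g ∙ h) ℕ.≤ f g + f h
  bounded⇒subadditive {f} c fε≡0 bounds g h with g Finₚ.≟ ε | h Finₚ.≟ ε | (g ∙ h) Finₚ.≟ ε
  ... | yes refl | _        | _        = ℕₚ.≤-trans (ℕₚ.≤-reflexive (cong f (identityˡ h))) (ℕₚ.m≤n+m (f h) (f ε))
  ... | no _     | yes refl | _        = ℕₚ.≤-trans (ℕₚ.≤-reflexive (cong f (identityʳ g))) (ℕₚ.m≤m+n (f g) (f ε))
  ... | no _     | no _     | yes gh≡ε = subst (ℕ._≤ f g + f h) (sym (trans (cong f gh≡ε) fε≡0)) ℕ.z≤n
  ... | no g≢ε   | no h≢ε   | no gh≢ε  =
    ℕₚ.≤-trans (proj₂ (bounds (g ∙ h) gh≢ε)) (ℕₚ.+-mono-≤ (proj₁ (bounds g g≢ε)) (proj₁ (bounds h h≢ε)))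

-- Orbits of inversion

module Orbits {n} (G : FiniteGroup n) where

  open FiniteGroup G
  open IsGroup isGroup using (assoc; identityˡ; inverseʳ)
  open GroupProperties (group G) using (⁻¹-involutive; ⁻¹-injective; ε⁻¹≈ε; inverseˡ-unique; identityˡ-unique)
  open Involution _⁻¹ ⁻¹-involutive
  open Finₚ using (_≟_; _≤?_)

  isNonIdentityMinimal : Fin n → Bool
  isNonIdentityMinimal x = ⌊ ¬? (x ≟ ε) ×-dec (x ≤? x ⁻¹) ⌋

  k : ℕ
  k = count isNonIdentityMinimal

  representatives : Fin k ↔ Σ (Fin n) (T ∘ isNonIdentityMinimal)
  representatives = count-↔ isNonIdentityMinimal

  open Inverse representatives using (to; from; strictlyInverseˡ; strictlyInverseʳ)

  ≡ε⇒≡⁻¹ : ∀ {g} → g ≡ ε → g ≡ g ⁻¹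
  ≡ε⇒≡⁻¹ refl = sym ε⁻¹≈ε

  ⁻¹≡ε⇒≡ε : ∀ {g} → g ⁻¹ ≡ ε → g ≡ ε
  ⁻¹≡ε⇒≡ε g⁻¹≡ε = ⁻¹-injective (trans g⁻¹≡ε (sym ε⁻¹≈ε))

  minRep≢ε : ∀ {g} → g ≢ ε → minRep g ≢ ε
  minRep≢ε {g} g≢ε with minRep-≡ g
  ... | inj₁ m≡g   = g≢ε ∘ trans (sym m≡g)
  ... | inj₂ m≡g⁻¹ = g≢ε ∘ ⁻¹≡ε⇒≡ε ∘ trans (sym m≡g⁻¹)

  -- Orbits are indexed by Fin (suc k): zero is {ε}, and suc a is {g, g⁻¹} for the a-th
  -- representative g, its smaller element in the order of Fin n.
  orbit : Fin n → Fin (suc k)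
  orbit g with g ≟ ε
  ... | yes _  = zero
  ... | no g≢ε = suc (from (minRep g , fromWitness (minRep≢ε g≢ε , minRep-minimal g)))

  rep : Fin (suc k) → Fin n
  rep zero    = ε
  rep (suc a) = proj₁ (to a)

  rep-suc≢ε : ∀ a → rep (suc a) ≢ ε
  rep-suc≢ε a = proj₁ (toWitness (proj₂ (to a)))

  orbit-≢ε : ∀ {g} (g≢ε : g ≢ ε) → orbit g ≡ suc (from (minRep g , fromWitness (minRep≢ε g≢ε , minRep-minimal g)))
  orbit-≢ε {g} g≢ε with g ≟ ε
  ... | yes g≡ε = contradiction g≡ε g≢ε
  ... | no _    = refl

  rep-orbit : ∀ g → rep (orbit g) ≡ g ⊎ rep (orbit g) ≡ g ⁻¹
  rep-orbit g with g ≟ ε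
  ... | yes g≡ε = inj₁ (sym g≡ε)
  ... | no _    = subst (λ x → x ≡ g ⊎ x ≡ g ⁻¹) (sym (cong proj₁ (strictlyInverseˡ _))) (minRep-≡ g)

  orbit-rep : ∀ o → orbit (rep o) ≡ o
  orbit-rep zero with ε ≟ ε
  ... | yes _  = refl
  ... | no ε≢ε = contradiction refl ε≢ε
  orbit-rep (suc a) = begin
    orbit (rep (suc a))                    ≡⟨ orbit-≢ε (rep-suc≢ε a) ⟩
    suc (from (minRep (rep (suc a)) , _))  ≡⟨ cong (suc ∘ from) (Σ-T-≡ (minRep-fixes rep≤rep⁻¹)) ⟩
    suc (from (to a))                      ≡⟨ cong suc (strictlyInverseʳ a) ⟩
    suc a                                  ∎
    where
    open ≡-Reasoning
    rep≤rep⁻¹ : rep (suc a) Fin.≤ rep (suc a) ⁻¹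
    rep≤rep⁻¹ = proj₂ (toWitness (proj₂ (to a)))

  orbit≡zero⇒≡ε : ∀ {g} → orbit g ≡ zero → g ≡ ε
  orbit≡zero⇒≡ε {g} orbit≡zero with rep-orbit g
  ... | inj₁ rep≡g   = trans (sym rep≡g) (cong rep orbit≡zero)
  ... | inj₂ rep≡g⁻¹ = ⁻¹≡ε⇒≡ε (trans (sym rep≡g⁻¹) (cong rep orbit≡zero))

  orbit-⁻¹ : ∀ g → orbit (g ⁻¹) ≡ orbit g
  orbit-⁻¹ g with g ≟ ε | g ⁻¹ ≟ ε
  ... | yes _   | yes _     = refl
  ... | yes g≡ε | no g⁻¹≢ε  = contradiction (trans (cong _⁻¹ g≡ε) ε⁻¹≈ε) g⁻¹≢ε
  ... | no g≢ε  | yes g⁻¹≡ε = contradiction (⁻¹≡ε⇒≡ε g⁻¹≡ε) g≢ε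
  ... | no _    | no _      = cong (suc ∘ from) (Σ-T-≡ (minRep-σ g))

  #minimal≡1+k : count isMinimal ≡ suc k
  #minimal≡1+k = begin
    count isMinimal
      ≡⟨ sum-cong-≗ (λ x → χ-split (x ≟ ε) (x ≤? x ⁻¹) (Finₚ.≤-reflexive ∘ ≡ε⇒≡⁻¹)) ⟩
    ∑[ x < n ] (χ ⌊ x ≟ ε ⌋ + χ (isNonIdentityMinimal x))
      ≡⟨ ∑-distrib-+ {n} (λ x → χ ⌊ x ≟ ε ⌋) (χ ∘ isNonIdentityMinimal) ⟩
    count (λ x → ⌊ x ≟ ε ⌋) + k
      ≡⟨ cong (_+ k) (count-≟ ε) ⟩
    suc k ∎
    where open ≡-Reasoning

  k₂≡#fixed : k₂ G ≡ count isFixed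
  k₂≡#fixed = trans (length-filter-tabulate (λ x → (x ∙ x) ≟ ε) id)
                    (count-cong (λ x → trans (sym (isYes≗does _)) (⌊⌋-⇔ square≡ε⇔≡⁻¹ ((x ∙ x) ≟ ε) (x ≟ x ⁻¹))))
    where
    square≡ε⇔≡⁻¹ : ∀ {x} → (x ∙ x) ≡ ε ⇔ x ≡ x ⁻¹
    square≡ε⇔≡⁻¹ {x} = mk⇔ (inverseˡ-unique x x) (λ x≡x⁻¹ → trans (cong (x ∙_) x≡x⁻¹) (inverseʳ x))

  n+k₂≡2[1+k] : n + k₂ G ≡ suc k + suc k
  n+k₂≡2[1+k] = begin
    n + k₂ G                           ≡⟨ cong (n +_) k₂≡#fixed ⟩
    n + count isFixed                  ≡⟨ n+#fixed≡2#minimal ⟩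
    count isMinimal + count isMinimal  ≡⟨ cong₂ _+_ #minimal≡1+k #minimal≡1+k ⟩
    suc k + suc k                      ∎
    where open ≡-Reasoning

  kG≡k : kG G ≡ k
  kG≡k = begin
    (n + k₂ G) / 2 ∸ 1       ≡⟨ cong (λ x → x / 2 ∸ 1) n+k₂≡2[1+k] ⟩
    (suc k + suc k) / 2 ∸ 1  ≡⟨ cong (_∸ 1) ([m+m]/2≡m (suc k)) ⟩
    k                        ∎
    where open ≡-Reasoning

  oddOrder⇒≡⁻¹⇒≡ε : n % 2 ≡ 1 → ∀ {t} → t ≡ t ⁻¹ → t ≡ ε
  oddOrder⇒≡⁻¹⇒≡ε odd {t} t≡t⁻¹ with t ≟ ε
  ... | yes t≡ε = t≡ε
  ... | no t≢ε  = contradiction (trans (sym odd) (Translation.fixedPointFree⇒even g≢t∙g)) λ ()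
    where
    t∙t≡ε : t ∙ t ≡ ε
    t∙t≡ε = trans (cong (t ∙_) t≡t⁻¹) (inverseʳ t)
    t∙-involutive : ∀ g → t ∙ (t ∙ g) ≡ g
    t∙-involutive g = trans (sym (assoc t t g)) (trans (cong (_∙ g) t∙t≡ε) (identityˡ g))
    module Translation = Involution (t ∙_) t∙-involutive
    g≢t∙g : ∀ g → g ≢ t ∙ g
    g≢t∙g g g≡t∙g = t≢ε (identityˡ-unique t g (sym g≡t∙g))

  oddOrder⇒k₂≡1 : n % 2 ≡ 1 → k₂ G ≡ 1
  oddOrder⇒k₂≡1 odd = begin
    k₂ G                     ≡⟨ k₂≡#fixed ⟩
    count isFixed            ≡⟨ count-cong (λ x → ⌊⌋-⇔ (mk⇔ (oddOrder⇒≡⁻¹⇒≡ε odd) ≡ε⇒≡⁻¹) (x ≟ x ⁻¹) (x ≟ ε)) ⟩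
    count (λ x → ⌊ x ≟ ε ⌋)  ≡⟨ count-≟ ε ⟩
    1                        ∎
    where open ≡-Reasoning

  oddOrder⇒[n∸1]/2≡k : n % 2 ≡ 1 → (n ∸ 1) / 2 ≡ k
  oddOrder⇒[n∸1]/2≡k odd = begin
    (n ∸ 1) / 2            ≡⟨ cong (λ x → (x ∸ 1) / 2) n≡1+2k ⟩
    (suc (k + k) ∸ 1) / 2  ≡⟨ [m+m]/2≡m k ⟩
    k                      ∎
    where
    open ≡-Reasoning
    n≡1+2k : n ≡ suc (k + k)
    n≡1+2k = ℕₚ.suc-injective (begin
      suc n              ≡⟨ ℕₚ.+-comm 1 n ⟩
      n + 1              ≡⟨ cong (n +_) (oddOrder⇒k₂≡1 odd) ⟨
      n + k₂ G           ≡⟨ n+k₂≡2[1+k] ⟩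
      suc k + suc k      ≡⟨ cong suc (ℕₚ.+-suc k k) ⟩
      suc (suc (k + k))  ∎)

-- Classification of the induced partitions

module Classification {n} (G : FiniteGroup n) where

  open FiniteGroup G
  open Norms G
  open Orbits G

  weight : ∀ {j} → Partition k j → Fin (suc k) → ℕ
  weight p zero    = 0
  weight p (suc a) = suc (k + toℕ (block p a))

  weight-bounds : ∀ {j} (p : Partition k j) o → o ≢ zero → suc k ℕ.≤ weight p o × weight p o ℕ.≤ suc k + suc k
  weight-bounds p zero    o≢zero = contradiction refl o≢zero
  weight-bounds p (suc a) _      = ℕ.s≤s (ℕₚ.m≤m+n k _) , ℕ.s≤s (ℕₚ.+-monoʳ-≤ k (ℕₚ.m≤n⇒m≤1+n block≤k))
    where
    block≤k : toℕ (block p a) ℕ.≤ k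
    block≤k = ℕₚ.<⇒≤ (ℕₚ.<-≤-trans (Finₚ.toℕ<n (block p a)) (Partition-bound p))

  weight∘suc-kernel : ∀ {j} (p : Partition k j) → SameKernel (weight p ∘ suc) (block p)
  weight∘suc-kernel p = SameKernel-sym (injective⇒SameKernel (Finₚ.toℕ-injective ∘ ℕₚ.+-cancelˡ-≡ (suc k) _ _))

  weight∘orbit-isNorm : ∀ {j} (p : Partition k j) → IsNorm (weight p ∘ orbit)
  weight∘orbit-isNorm p = record
    { ≡0⇒≡ε        = λ g w≡0 → orbit≡zero⇒≡ε (weight≡0⇒zero (orbit g) w≡0)
    ; ε↦0          = ε↦0
    ; ⁻¹-invariant = cong (weight p) ∘ orbit-⁻¹
    ; subadditive  = bounded⇒subadditive (suc k) ε↦0 (λ g g≢ε → weight-bounds p (orbit g) (g≢ε ∘ orbit≡zero⇒≡ε))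
    }
    where
    weight≡0⇒zero : ∀ o → weight p o ≡ 0 → o ≡ zero
    weight≡0⇒zero zero _ = refl
    ε↦0 : weight p (orbit ε) ≡ 0
    ε↦0 = cong (weight p) (orbit-rep zero)

  partitionMetric : Σ ℕ (Partition k) → RIMetric G
  partitionMetric (_ , p) = normMetric (weight∘orbit-isNorm p)

  partitionMetric-kernel : ∀ {j} (p : Partition k j) → SameKernel (norm (partitionMetric (j , p))) (weight p ∘ orbit)
  partitionMetric-kernel p = normMetric-kernel (weight∘orbit-isNorm p)

  partitionMetric-injective : ∀ P Q → PEquiv G (partitionMetric P) (partitionMetric Q) → P ≡ Q
  partitionMetric-injective (_ , p) (_ , q) same =
    block-kernel-injective p q
      (SameKernel-trans (SameKernel-sym (weight∘suc-kernel p))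
        (SameKernel-trans (λ a b → same-weights (suc a) (suc b)) (weight∘suc-kernel q)))
    where
    same-weights : SameKernel (weight p) (weight q)
    same-weights = SameKernel-reflect-∘ orbit rep orbit-rep
      (SameKernel-trans (SameKernel-sym (partitionMetric-kernel p)) (SameKernel-trans same (partitionMetric-kernel q)))

  module _ (m : RIMetric G) where

    private
      v : Fin (suc k) → ℚ
      v = norm m ∘ rep

      fibres = fibrePartition ℚₚ._≟_ (v ∘ suc)

    partitionOfMetric : Σ ℕ (Partition k)
    partitionOfMetric = proj₁ fibres

    partitionOfMetric-PEquiv : PEquiv G m (partitionMetric partitionOfMetric)
    partitionOfMetric-PEquiv =
      SameKernel-sym (SameKernel-trans (partitionMetric-kernel p)
                       (SameKernel-trans (λ x y → weight~v (orbit x) (orbit y)) (≗⇒SameKernel v∘orbit≗norm)))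
      where
      p = proj₂ partitionOfMetric

      v₀≢v∘suc : ∀ a → v zero ≢ v (suc a)
      v₀≢v∘suc a v₀≡v = rep-suc≢ε a (norm≡0⇒≡ε m (rep (suc a)) (trans (sym v₀≡v) (norm-ε m)))

      weight~v : SameKernel (weight p) v
      weight~v = SameKernel-extend (λ _ ()) v₀≢v∘suc (SameKernel-trans (weight∘suc-kernel p) (proj₂ fibres))

      v∘orbit≗norm : ∀ g → v (orbit g) ≡ norm m g
      v∘orbit≗norm g with rep-orbit g
      ... | inj₁ rep≡g   = cong (norm m) rep≡g
      ... | inj₂ rep≡g⁻¹ = trans (cong (norm m) rep≡g⁻¹) (norm-⁻¹ m g)

  M≡Bell[k] : MEquals G (Bell k)
  M≡Bell[k] = partitionMetric ∘ to
            , (λ i j same → Injection.injective (↔⇒↣ (Bell-↔ k)) (partitionMetric-injective _ _ same))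
            , λ m → from (partitionOfMetric m)
                  , subst (PEquiv G m ∘ partitionMetric) (sym (strictlyInverseˡ _)) (partitionOfMetric-PEquiv m)
    where open Inverse (Bell-↔ k) using (to; from; strictlyInverseˡ)

proposition5p1 : ∀ {n : ℕ} (G : FiniteGroup n) →
    MEquals G (Bell (kG G)) × (n % 2 ≡ 1 → MEquals G (Bell ((n ∸ 1) / 2)))
proposition5p1 G =
    subst (MEquals G ∘ Bell) (sym kG≡k) M≡Bell[k]
  , λ odd → subst (MEquals G ∘ Bell) (sym (oddOrder⇒[n∸1]/2≡k odd)) M≡Bell[k]
  where
  open Orbits G using (kG≡k; oddOrder⇒[n∸1]/2≡k)
  open Classification G using (M≡Bell[k])
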